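{- In the strongly focused calculus: (a) in the presence of rules $I_{1a},I_{1b}$, if $\Pi_2\mathbin{\cdot\oslash\cdot}\Sigma_2,\Sigma_1\mathbin{\cdot\oslash\cdot}\Pi_1\vdash$ then $\Pi_1\mathbin{\cdot\otimes\cdot}\Pi_2,\Sigma_2\mathbin{\cdot\otimes\cdot}\Sigma_1\vdash$; (b) in the presence of rules $I_{2a},I_{2b}$, if $\Sigma_1\mathbin{\cdot\ominus\cdot}\Pi_1,\Pi_2\mathbin{\cdot\ominus\cdot}\Sigma_2\vdash$ then $\Pi_1\mathbin{\cdot\otimes\cdot}\Pi_2,\Sigma_2\mathbin{\cdot\otimes\cdot}\Sigma_1\vdash$; (c) in the presence of rules $IV_a$–$IV_d$, if $\Sigma_2\mathbin{\cdot\oslash\cdot}\Pi_1,\Sigma_1\mathbin{\cdot\ominus\cdot}\Pi_2\vdash$ then $\Pi_1\mathbin{\cdot\otimes\cdot}\Pi_2,\Sigma_2\mathbin{\cdot\otimes\cdot}\Sigma_1\vdash$.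
   Context: Notation: $\otimes$ tensor, $\oplus$ par, $/,\backslash$ implications, $\oslash$ right coimplication, $\ominus$ left coimplication (circled slash / circled backslash in the source); $\mathbin{\cdot\otimes\cdot},\mathbin{\cdot\oslash\cdot},\mathbin{\cdot\ominus\cdot}$ are their structural counterparts. Polarized formulas: $P,Q ::= p\mid P\otimes Q\mid P\oslash N\mid N\ominus P\mid P\lor Q\mid{\downarrow}N$, $N,M ::= \bar p\mid M\oplus N\mid Q\backslash M\mid M/Q\mid M\land N\mid{\uparrow}P$, with linear negation $p^\bot=\bar p$, $(P\otimes Q)^\bot=Q^\bot\oplus P^\bot$, $(N\ominus P)^\bot=P^\bot/N^\bot$, $(P\oslash N)^\bot=N^\bot\backslash P^\bot$, $(P\lor Q)^\bot=Q^\bot\land P^\bot$, $({\downarrow}N)^\bot={\uparrow}N^\bot$ and converses. Strong focalization relative to a set $X$ of negative formulas: $\sigma({\uparrow}P)=\{P^\bot\}\cup\tau(P)$, $\sigma(\bar p)=\{\bar p\}$, $\sigma(M\land N)=\sigma(M\oplus N)=\sigma(M)\cup\sigma(N)$, $\sigma(M/Q)=\sigma(Q\backslash M)=\sigma(M)\cup\tau(Q)$; $\tau({\downarrow}N)=\{N\}\cup\sigma(N)$, $\tau(p)=\{p\}$, $\tau(P\lor Q)=\tau(P\otimes Q)=\tau(P)\cup\tau(Q)$, $\tau(N\ominus P)=\tau(P\oslash N)=\tau(P)\cup\sigma(N)$; $X^\tau=\bigcup_{N\in X}\tau({\downarrow}N)$. Focused structures $\Pi,\Sigma,\Upsilon ::=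 p\mid N\mid\Pi\mathbin{\cdot\otimes\cdot}\Sigma\mid\Pi\mathbin{\cdot\oslash\cdot}\Sigma\mid\Sigma\mathbin{\cdot\ominus\cdot}\Pi$ ($p,N\in X^\tau$). $\mathrm{inv}(p)=\{p\}$, $\mathrm{inv}({\downarrow}N)=\{N\}$, $\mathrm{inv}(P\lor Q)=\mathrm{inv}(P)\cup\mathrm{inv}(Q)$, $\mathrm{inv}(P\otimes Q)=\{\Pi\mathbin{\cdot\otimes\cdot}\Sigma\mid\Pi\in\mathrm{inv}(P),\Sigma\in\mathrm{inv}(Q)\}$, $\mathrm{inv}(P\oslash N)=\{\Pi\mathbin{\cdot\oslash\cdot}\Sigma\mid\Pi\in\mathrm{inv}(P),\Sigma\in\mathrm{inv}(N^\bot)\}$, $\mathrm{inv}(N\ominus P)=\{\Sigma\mathbin{\cdot\ominus\cdot}\Pi\mid\Pi\in\mathrm{inv}(P),\Sigma\in\mathrm{inv}(N^\bot)\}$. For a one-hole context $\omega[\,]$ equal to $\Pi[\,],\Sigma$ or $\Sigma,\Pi[\,]$, $\omega^*[\,]=\Pi[\,]\div\Sigma$, with $[\,]\div\Upsilon=\Upsilon$, $(\Pi[\,]\mathbin{\cdot\otimes\cdot}\Sigma)\div\Upsilon=\Pi[\,]\div(\Sigma\mathbin{\cdot\ominus\cdot}\Upsilon)$, $(\Pi\mathbin{\cdot\otimes\cdot}\Sigma[\,])\div\Upsilon=\Sigma[\,]\div(\Upsilon\mathbin{\cdot\oslash\cdot}\Pi)$, $(\Pi[\,]\mathbin{\cdot\oslash\cdot}\Sigma)\div\Upsilon=\Pi[\,]\div(\Sigma\mathbin{\cdot\otimes\cdot}\Upsilon)$,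 $(\Sigma\mathbin{\cdot\ominus\cdot}\Pi[\,])\div\Upsilon=\Pi[\,]\div(\Upsilon\mathbin{\cdot\otimes\cdot}\Sigma)$, $(\Pi\mathbin{\cdot\oslash\cdot}\Sigma[\,])\div\Upsilon=\Sigma[\,]\div(\Upsilon\mathbin{\cdot\ominus\cdot}\Pi)$, $(\Sigma[\,]\mathbin{\cdot\ominus\cdot}\Pi)\div\Upsilon=\Sigma[\,]\div(\Pi\mathbin{\cdot\oslash\cdot}\Upsilon)$. Rules: (D) from $\omega^*[\,]\vdash\Sigma$ infer $\omega[N]\vdash$, for $N\in X^\tau$, $\Sigma\in\mathrm{inv}(N^\bot)$ (the only rule concluding $\Pi,\Sigma\vdash$); (I) $p\vdash p$; (R) from $\Pi,\Sigma\vdash$ for all $\Sigma\in\mathrm{inv}(N^\bot)$ infer $\Pi\vdash N$; from $\Pi\vdash\Pi'$ and $\Sigma\vdash\Sigma'$ infer $\Pi\mathbin{\cdot\otimes\cdot}\Sigma\vdash\Pi'\mathbin{\cdot\otimes\cdot}\Sigma'$, $\Sigma\mathbin{\cdot\ominus\cdot}\Pi\vdash\Sigma'\mathbin{\cdot\ominus\cdot}\Pi'$, $\Pi\mathbin{\cdot\oslash\cdot}\Sigma\vdash\Pi'\mathbin{\cdot\oslash\cdot}\Sigma'$. Linear distributivity rules for focused derivations (each: from $\Pi[\text{first}]\vdash\Upsilon$ infer $\Pi[\text{second}]\vdash\Upsilon$, for any context $\Pi[\,]$): $I_{1a}$: $\Delta_1\mathbin{\cdot\otimes\cdot}(\Delta_2\mathbin{\cdot\oslash\cdot}\Delta_3)$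 to $(\Delta_1\mathbin{\cdot\otimes\cdot}\Delta_2)\mathbin{\cdot\oslash\cdot}\Delta_3$; $I_{1b}$: $(\Delta_1\mathbin{\cdot\oslash\cdot}\Delta_2)\mathbin{\cdot\ominus\cdot}\Delta_3$ to $\Delta_1\mathbin{\cdot\ominus\cdot}(\Delta_2\mathbin{\cdot\otimes\cdot}\Delta_3)$; $I_{2a}$: $(\Delta_1\mathbin{\cdot\ominus\cdot}\Delta_2)\mathbin{\cdot\otimes\cdot}\Delta_3$ to $\Delta_1\mathbin{\cdot\ominus\cdot}(\Delta_2\mathbin{\cdot\otimes\cdot}\Delta_3)$; $I_{2b}$: $\Delta_1\mathbin{\cdot\oslash\cdot}(\Delta_2\mathbin{\cdot\ominus\cdot}\Delta_3)$ to $(\Delta_1\mathbin{\cdot\otimes\cdot}\Delta_2)\mathbin{\cdot\oslash\cdot}\Delta_3$; $IV_a$: $\Delta_1\mathbin{\cdot\otimes\cdot}(\Delta_2\mathbin{\cdot\ominus\cdot}\Delta_3)$ to $\Delta_2\mathbin{\cdot\ominus\cdot}(\Delta_1\mathbin{\cdot\otimes\cdot}\Delta_3)$; $IV_b$: $(\Delta_1\mathbin{\cdot\ominus\cdot}\Delta_2)\mathbin{\cdot\ominus\cdot}\Delta_3$ to $\Delta_2\mathbin{\cdot\ominus\cdot}(\Delta_3\mathbin{\cdot\otimes\cdot}\Delta_1)$; $IV_c$: $(\Delta_1\mathbin{\cdot\oslash\cdot}\Delta_2)\mathbin{\cdot\otimes\cdot}\Delta_3$ to $(\Delta_1\mathbin{\cdot\otimes\cdot}\Delta_3)\mathbin{\cdot\oslash\cdot}\Delta_2$;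 $IV_d$: $\Delta_1\mathbin{\cdot\oslash\cdot}(\Delta_2\mathbin{\cdot\oslash\cdot}\Delta_3)$ to $(\Delta_3\mathbin{\cdot\otimes\cdot}\Delta_1)\mathbin{\cdot\oslash\cdot}\Delta_2$. -}

module Defs where

open import Data.Nat using (ℕ)
open import Data.Product using (Σ; _×_; _,_)
open import Data.Sum using (_⊎_)
open import Relation.Binary.PropositionalEquality using (_≡_)

infixr 6 _⊗_ _⊕_
infixr 5 _∨_ _∧_

mutual
  data Pos : Set where
    at   : ℕ → Pos
    _⊗_  : Pos → Pos → Pos
    _⊘_  : Pos → Neg → Pos
    _⊖_  : Neg → Pos → Pos
    _∨_  : Pos → Pos → Pos
    ↓_   : Neg → Pos

  data Neg : Set where
    nat  : ℕ → Neg
    _⊕_  : Neg → Neg → Neg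
    _∖_  : Pos → Neg → Neg
    _/_  : Neg → Pos → Neg
    _∧_  : Neg → Neg → Neg
    ↑_   : Pos → Neg

mutual
  _⊥⁺ : Pos → Neg
  at p ⊥⁺    = nat p
  (P ⊗ Q) ⊥⁺ = (Q ⊥⁺) ⊕ (P ⊥⁺)
  (N ⊖ P) ⊥⁺ = (P ⊥⁺) / (N ⊥⁻)
  (P ⊘ N) ⊥⁺ = (N ⊥⁻) ∖ (P ⊥⁺)
  (P ∨ Q) ⊥⁺ = (Q ⊥⁺) ∧ (P ⊥⁺)
  (↓ N) ⊥⁺   = ↑ (N ⊥⁻)

  _⊥⁻ : Neg → Pos
  nat p ⊥⁻   = at p
  (M ⊕ N) ⊥⁻ = (N ⊥⁻) ⊗ (M ⊥⁻)
  (M / Q) ⊥⁻ = (Q ⊥⁺) ⊖ (M ⊥⁻)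
  (Q ∖ M) ⊥⁻ = (M ⊥⁻) ⊘ (Q ⊥⁺)
  (M ∧ N) ⊥⁻ = (N ⊥⁻) ∨ (M ⊥⁻)
  (↑ P) ⊥⁻   = ↓ (P ⊥⁺)

data Leaf : Set where
  atm : ℕ → Leaf
  neg : Neg → Leaf

mutual
  data _∈σ_ (L : Leaf) : Neg → Set where
    σ↑   : ∀ {P} → L ≡ neg (P ⊥⁺) → L ∈σ (↑ P)
    σ↑τ  : ∀ {P} → L ∈τ P → L ∈σ (↑ P)
    σat  : ∀ {p} → L ≡ neg (nat p) → L ∈σ nat p
    σ∧ˡ  : ∀ {M N} → L ∈σ M → L ∈σ (M ∧ N)
    σ∧ʳ  : ∀ {M N} → L ∈σ N → L ∈σ (M ∧ N)
    σ⊕ˡ  : ∀ {M N} → L ∈σ M → L ∈σ (M ⊕ N)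
    σ⊕ʳ  : ∀ {M N} → L ∈σ N → L ∈σ (M ⊕ N)
    σ/ˡ  : ∀ {M Q} → L ∈σ M → L ∈σ (M / Q)
    σ/ʳ  : ∀ {M Q} → L ∈τ Q → L ∈σ (M / Q)
    σ∖ˡ  : ∀ {M Q} → L ∈σ M → L ∈σ (Q ∖ M)
    σ∖ʳ  : ∀ {M Q} → L ∈τ Q → L ∈σ (Q ∖ M)

  data _∈τ_ (L : Leaf) : Pos → Set where
    τ↓   : ∀ {N} → L ≡ neg N → L ∈τ (↓ N)
    τ↓σ  : ∀ {N} → L ∈σ N → L ∈τ (↓ N)
    τat  : ∀ {p} → L ≡ atm p → L ∈τ at p
    τ∨ˡ  : ∀ {P Q} → L ∈τ P → L ∈τ (P ∨ Q)
    τ∨ʳ  : ∀ {P Q} → L ∈τ Q → L ∈τ (P ∨ Q)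
    τ⊗ˡ  : ∀ {P Q} → L ∈τ P → L ∈τ (P ⊗ Q)
    τ⊗ʳ  : ∀ {P Q} → L ∈τ Q → L ∈τ (P ⊗ Q)
    τ⊖ˡ  : ∀ {N P} → L ∈τ P → L ∈τ (N ⊖ P)
    τ⊖ʳ  : ∀ {N P} → L ∈σ N → L ∈τ (N ⊖ P)
    τ⊘ˡ  : ∀ {N P} → L ∈τ P → L ∈τ (P ⊘ N)
    τ⊘ʳ  : ∀ {N P} → L ∈σ N → L ∈τ (P ⊘ N)

_∈Xτ_ : Leaf → (Neg → Set) → Set
L ∈Xτ X = Σ Neg (λ N → X N × L ∈τ (↓ N))

infixr 6 _·⊗·_ _·⊘·_ _·⊖·_

data Str : Set where
  leaf   : Leaf → Str
  _·⊗·_  : Str → Str → Str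
  _·⊘·_  : Str → Str → Str
  _·⊖·_  : Str → Str → Str

data Focused (X : Neg → Set) : Str → Set where
  f-leaf : ∀ {L} → L ∈Xτ X → Focused X (leaf L)
  f-⊗    : ∀ {A B} → Focused X A → Focused X B → Focused X (A ·⊗· B)
  f-⊘    : ∀ {A B} → Focused X A → Focused X B → Focused X (A ·⊘· B)
  f-⊖    : ∀ {A B} → Focused X A → Focused X B → Focused X (A ·⊖· B)

data _∈inv_ : Str → Pos → Set where
  inv-at : ∀ {p} → leaf (atm p) ∈inv at p
  inv-↓  : ∀ {N} → leaf (neg N) ∈inv (↓ N)
  inv-∨ˡ : ∀ {Π P Q} → Π ∈inv P → Π ∈inv (P ∨ Q)
  inv-∨ʳ : ∀ {Π P Q} → Π ∈inv Q → Π ∈inv (P ∨ Q)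
  inv-⊗  : ∀ {Π Σ' P Q} → Π ∈inv P → Σ' ∈inv Q → (Π ·⊗· Σ') ∈inv (P ⊗ Q)
  inv-⊘  : ∀ {Π Σ' P N} → Π ∈inv P → Σ' ∈inv (N ⊥⁻) → (Π ·⊘· Σ') ∈inv (P ⊘ N)
  inv-⊖  : ∀ {Π Σ' P N} → Π ∈inv P → Σ' ∈inv (N ⊥⁻) → (Σ' ·⊖· Π) ∈inv (N ⊖ P)

data Ctx : Set where
  hole  : Ctx
  ⊗ₗ    : Ctx → Str → Ctx
  ⊗ᵣ    : Str → Ctx → Ctx
  ⊘ₗ    : Ctx → Str → Ctx
  ⊘ᵣ    : Str → Ctx → Ctx
  ⊖ₗ    : Ctx → Str → Ctx
  ⊖ᵣ    : Str → Ctx → Ctx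

_[_] : Ctx → Str → Str
hole [ A ]     = A
⊗ₗ C S [ A ]   = (C [ A ]) ·⊗· S
⊗ᵣ S C [ A ]   = S ·⊗· (C [ A ])
⊘ₗ C S [ A ]   = (C [ A ]) ·⊘· S
⊘ᵣ S C [ A ]   = S ·⊘· (C [ A ])
⊖ₗ C S [ A ]   = (C [ A ]) ·⊖· S
⊖ᵣ S C [ A ]   = S ·⊖· (C [ A ])

_÷_ : Ctx → Str → Str
hole ÷ U     = U
⊗ₗ C S ÷ U   = C ÷ (S ·⊖· U)
⊗ᵣ S C ÷ U   = C ÷ (U ·⊘· S)
⊘ₗ C S ÷ U   = C ÷ (S ·⊗· U)
⊖ᵣ S C ÷ U   = C ÷ (U ·⊗· S)
⊘ᵣ S C ÷ U   = C ÷ (U ·⊖· S)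
⊖ₗ C S ÷ U   = C ÷ (S ·⊘· U)

data LD : Set where
  I1a I1b I2a I2b IVa IVb IVc IVd : LD

-- ld r A B : rule r rewrites the substructure A (first) into B (second)
data ld : LD → Str → Str → Set where
  r-I1a : ∀ {D1 D2 D3} → ld I1a (D1 ·⊗· (D2 ·⊘· D3)) ((D1 ·⊗· D2) ·⊘· D3)
  r-I1b : ∀ {D1 D2 D3} → ld I1b ((D1 ·⊘· D2) ·⊖· D3) (D1 ·⊖· (D2 ·⊗· D3))
  r-I2a : ∀ {D1 D2 D3} → ld I2a ((D1 ·⊖· D2) ·⊗· D3) (D1 ·⊖· (D2 ·⊗· D3))
  r-I2b : ∀ {D1 D2 D3} → ld I2b (D1 ·⊘· (D2 ·⊖· D3)) ((D1 ·⊗· D2) ·⊘· D3)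
  r-IVa : ∀ {D1 D2 D3} → ld IVa (D1 ·⊗· (D2 ·⊖· D3)) (D2 ·⊖· (D1 ·⊗· D3))
  r-IVb : ∀ {D1 D2 D3} → ld IVb ((D1 ·⊖· D2) ·⊖· D3) (D2 ·⊖· (D3 ·⊗· D1))
  r-IVc : ∀ {D1 D2 D3} → ld IVc ((D1 ·⊘· D2) ·⊗· D3) ((D1 ·⊗· D3) ·⊘· D2)
  r-IVd : ∀ {D1 D2 D3} → ld IVd (D1 ·⊘· (D2 ·⊘· D3)) ((D3 ·⊗· D1) ·⊘· D2)

RI1 RI2 RIV : LD → Set
RI1 r = r ≡ I1a ⊎ r ≡ I1b
RI2 r = r ≡ I2a ⊎ r ≡ I2b
RIV r = (r ≡ IVa ⊎ r ≡ IVb) ⊎ (r ≡ IVc ⊎ r ≡ IVd)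

mutual
  data _∣_⊩_,_⊢ (X : Neg → Set) (R : LD → Set) : Str → Str → Set where
    -- (D), hole on the left of the pair:  ω[N] = Π[N] , S
    D-l : ∀ {N} (C : Ctx) (S Σ' : Str) → neg N ∈Xτ X → Σ' ∈inv (N ⊥⁻) →
          X ∣ R ⊩ (C ÷ S) ⊢ Σ' → X ∣ R ⊩ (C [ leaf (neg N) ]) , S ⊢
    -- (D), hole on the right of the pair: ω[N] = S , Π[N]
    D-r : ∀ {N} (C : Ctx) (S Σ' : Str) → neg N ∈Xτ X → Σ' ∈inv (N ⊥⁻) →
          X ∣ R ⊩ (C ÷ S) ⊢ Σ' → X ∣ R ⊩ S , (C [ leaf (neg N) ]) ⊢

  data _∣_⊩_⊢_ (X : Neg → Set) (R : LD → Set) : Str → Str → Set where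
    I  : ∀ {p} → X ∣ R ⊩ leaf (atm p) ⊢ leaf (atm p)
    Rr : ∀ {Π N} → (∀ Σ' → Σ' ∈inv (N ⊥⁻) → X ∣ R ⊩ Π , Σ' ⊢) →
         X ∣ R ⊩ Π ⊢ leaf (neg N)
    ⊗r : ∀ {A A' B B'} → X ∣ R ⊩ A ⊢ A' → X ∣ R ⊩ B ⊢ B' →
         X ∣ R ⊩ (A ·⊗· B) ⊢ (A' ·⊗· B')
    ⊖r : ∀ {A A' B B'} → X ∣ R ⊩ A ⊢ A' → X ∣ R ⊩ B ⊢ B' →
         X ∣ R ⊩ (A ·⊖· B) ⊢ (A' ·⊖· B')
    ⊘r : ∀ {A A' B B'} → X ∣ R ⊩ A ⊢ A' → X ∣ R ⊩ B ⊢ B' →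
         X ∣ R ⊩ (A ·⊘· B) ⊢ (A' ·⊘· B')
    LDr : ∀ {r A B U} (C : Ctx) → R r → ld r A B →
          X ∣ R ⊩ (C [ A ]) ⊢ U → X ∣ R ⊩ (C [ B ]) ⊢ U

module Submission where

open import Defs
open import Data.Product using (_×_; _,_)
open import Data.Sum using (inj₁; inj₂)
open import Relation.Binary.PropositionalEquality using (_≡_; refl; subst; sym)

-- The premise of (D) depends on the conclusion only through ω*[ ] = Π[ ] ÷ Σ.
-- Moving the focused leaf from one component of the pair to another changes Σ
-- by exactly one linear distributivity step at the root, and since ÷ is
-- plugging into a context, that step is an instance of the rule in context.

_÷ᶜ_ : Ctx → Ctx → Ctx
hole     ÷ᶜ E = E
⊗ₗ C S   ÷ᶜ E = C ÷ᶜ ⊖ᵣ S E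
⊗ᵣ S C   ÷ᶜ E = C ÷ᶜ ⊘ₗ E S
⊘ₗ C S   ÷ᶜ E = C ÷ᶜ ⊗ᵣ S E
⊖ᵣ S C   ÷ᶜ E = C ÷ᶜ ⊗ₗ E S
⊘ᵣ S C   ÷ᶜ E = C ÷ᶜ ⊖ₗ E S
⊖ₗ C S   ÷ᶜ E = C ÷ᶜ ⊘ᵣ S E

÷-[] : ∀ C E U → C ÷ (E [ U ]) ≡ (C ÷ᶜ E) [ U ]
÷-[] hole     E U = refl
÷-[] (⊗ₗ C S) E U = ÷-[] C (⊖ᵣ S E) U
÷-[] (⊗ᵣ S C) E U = ÷-[] C (⊘ₗ E S) U
÷-[] (⊘ₗ C S) E U = ÷-[] C (⊗ᵣ S E) U
÷-[] (⊖ᵣ S C) E U = ÷-[] C (⊗ₗ E S) U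
÷-[] (⊘ᵣ S C) E U = ÷-[] C (⊖ₗ E S) U
÷-[] (⊖ₗ C S) E U = ÷-[] C (⊘ᵣ S E) U

LD-÷ : ∀ {X R r A B V} (C : Ctx) → R r → ld r A B →
       X ∣ R ⊩ C ÷ A ⊢ V → X ∣ R ⊩ C ÷ B ⊢ V
LD-÷ {X} {R} {V = V} C r∈R step d =
  subst (λ Z → X ∣ R ⊩ Z ⊢ V) (sym (÷-[] C hole _))
    (LDr (C ÷ᶜ hole) r∈R step (subst (λ Z → X ∣ R ⊩ Z ⊢ V) (÷-[] C hole _) d))

-- The pair is passed through equations because C [ leaf (neg N) ] in the
-- conclusion of (D) does not unify with a constructor pattern.
I1-⊘⊘⇒⊗⊗ : ∀ {X P Q Π₁ Π₂ Σ₁ Σ₂} → X ∣ RI1 ⊩ P , Q ⊢ →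
  P ≡ Π₂ ·⊘· Σ₂ → Q ≡ Σ₁ ·⊘· Π₁ → X ∣ RI1 ⊩ Π₁ ·⊗· Π₂ , Σ₂ ·⊗· Σ₁ ⊢
I1-⊘⊘⇒⊗⊗ (D-l (⊘ₗ C _) _ Σ' x i d) refl refl = D-l (⊗ᵣ _ C) _ Σ' x i (LD-÷ C (inj₁ refl) r-I1a d)
I1-⊘⊘⇒⊗⊗ (D-l (⊘ᵣ _ C) _ Σ' x i d) refl refl = D-r (⊗ₗ C _) _ Σ' x i (LD-÷ C (inj₂ refl) r-I1b d)
I1-⊘⊘⇒⊗⊗ (D-r (⊘ₗ C _) _ Σ' x i d) refl refl = D-r (⊗ᵣ _ C) _ Σ' x i (LD-÷ C (inj₁ refl) r-I1a d)
I1-⊘⊘⇒⊗⊗ (D-r (⊘ᵣ _ C) _ Σ' x i d) refl refl = D-l (⊗ₗ C _) _ Σ' x i (LD-÷ C (inj₂ refl) r-I1b d)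
I1-⊘⊘⇒⊗⊗ (D-l hole     _ _ _ _ _) () _
I1-⊘⊘⇒⊗⊗ (D-l (⊗ₗ _ _) _ _ _ _ _) () _
I1-⊘⊘⇒⊗⊗ (D-l (⊗ᵣ _ _) _ _ _ _ _) () _
I1-⊘⊘⇒⊗⊗ (D-l (⊖ₗ _ _) _ _ _ _ _) () _
I1-⊘⊘⇒⊗⊗ (D-l (⊖ᵣ _ _) _ _ _ _ _) () _
I1-⊘⊘⇒⊗⊗ (D-r hole     _ _ _ _ _) _ ()
I1-⊘⊘⇒⊗⊗ (D-r (⊗ₗ _ _) _ _ _ _ _) _ ()
I1-⊘⊘⇒⊗⊗ (D-r (⊗ᵣ _ _) _ _ _ _ _) _ ()
I1-⊘⊘⇒⊗⊗ (D-r (⊖ₗ _ _) _ _ _ _ _) _ ()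
I1-⊘⊘⇒⊗⊗ (D-r (⊖ᵣ _ _) _ _ _ _ _) _ ()

I2-⊖⊖⇒⊗⊗ : ∀ {X P Q Π₁ Π₂ Σ₁ Σ₂} → X ∣ RI2 ⊩ P , Q ⊢ →
  P ≡ Σ₁ ·⊖· Π₁ → Q ≡ Π₂ ·⊖· Σ₂ → X ∣ RI2 ⊩ Π₁ ·⊗· Π₂ , Σ₂ ·⊗· Σ₁ ⊢
I2-⊖⊖⇒⊗⊗ (D-l (⊖ₗ C _) _ Σ' x i d) refl refl = D-r (⊗ᵣ _ C) _ Σ' x i (LD-÷ C (inj₂ refl) r-I2b d)
I2-⊖⊖⇒⊗⊗ (D-l (⊖ᵣ _ C) _ Σ' x i d) refl refl = D-l (⊗ₗ C _) _ Σ' x i (LD-÷ C (inj₁ refl) r-I2a d)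
I2-⊖⊖⇒⊗⊗ (D-r (⊖ₗ C _) _ Σ' x i d) refl refl = D-l (⊗ᵣ _ C) _ Σ' x i (LD-÷ C (inj₂ refl) r-I2b d)
I2-⊖⊖⇒⊗⊗ (D-r (⊖ᵣ _ C) _ Σ' x i d) refl refl = D-r (⊗ₗ C _) _ Σ' x i (LD-÷ C (inj₁ refl) r-I2a d)
I2-⊖⊖⇒⊗⊗ (D-l hole     _ _ _ _ _) () _
I2-⊖⊖⇒⊗⊗ (D-l (⊗ₗ _ _) _ _ _ _ _) () _
I2-⊖⊖⇒⊗⊗ (D-l (⊗ᵣ _ _) _ _ _ _ _) () _
I2-⊖⊖⇒⊗⊗ (D-l (⊘ₗ _ _) _ _ _ _ _) () _
I2-⊖⊖⇒⊗⊗ (D-l (⊘ᵣ _ _) _ _ _ _ _) () _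
I2-⊖⊖⇒⊗⊗ (D-r hole     _ _ _ _ _) _ ()
I2-⊖⊖⇒⊗⊗ (D-r (⊗ₗ _ _) _ _ _ _ _) _ ()
I2-⊖⊖⇒⊗⊗ (D-r (⊗ᵣ _ _) _ _ _ _ _) _ ()
I2-⊖⊖⇒⊗⊗ (D-r (⊘ₗ _ _) _ _ _ _ _) _ ()
I2-⊖⊖⇒⊗⊗ (D-r (⊘ᵣ _ _) _ _ _ _ _) _ ()

IV-⊘⊖⇒⊗⊗ : ∀ {X P Q Π₁ Π₂ Σ₁ Σ₂} → X ∣ RIV ⊩ P , Q ⊢ →
  P ≡ Σ₂ ·⊘· Π₁ → Q ≡ Σ₁ ·⊖· Π₂ → X ∣ RIV ⊩ Π₁ ·⊗· Π₂ , Σ₂ ·⊗· Σ₁ ⊢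
IV-⊘⊖⇒⊗⊗ (D-l (⊘ₗ C _) _ Σ' x i d) refl refl = D-r (⊗ₗ C _) _ Σ' x i (LD-÷ C (inj₁ (inj₁ refl)) r-IVa d)
IV-⊘⊖⇒⊗⊗ (D-l (⊘ᵣ _ C) _ Σ' x i d) refl refl = D-l (⊗ₗ C _) _ Σ' x i (LD-÷ C (inj₁ (inj₂ refl)) r-IVb d)
IV-⊘⊖⇒⊗⊗ (D-r (⊖ₗ C _) _ Σ' x i d) refl refl = D-r (⊗ᵣ _ C) _ Σ' x i (LD-÷ C (inj₂ (inj₂ refl)) r-IVd d)
IV-⊘⊖⇒⊗⊗ (D-r (⊖ᵣ _ C) _ Σ' x i d) refl refl = D-l (⊗ᵣ _ C) _ Σ' x i (LD-÷ C (inj₂ (inj₁ refl)) r-IVc d)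
IV-⊘⊖⇒⊗⊗ (D-l hole     _ _ _ _ _) () _
IV-⊘⊖⇒⊗⊗ (D-l (⊗ₗ _ _) _ _ _ _ _) () _
IV-⊘⊖⇒⊗⊗ (D-l (⊗ᵣ _ _) _ _ _ _ _) () _
IV-⊘⊖⇒⊗⊗ (D-l (⊖ₗ _ _) _ _ _ _ _) () _
IV-⊘⊖⇒⊗⊗ (D-l (⊖ᵣ _ _) _ _ _ _ _) () _
IV-⊘⊖⇒⊗⊗ (D-r hole     _ _ _ _ _) _ ()
IV-⊘⊖⇒⊗⊗ (D-r (⊗ₗ _ _) _ _ _ _ _) _ ()
IV-⊘⊖⇒⊗⊗ (D-r (⊗ᵣ _ _) _ _ _ _ _) _ ()
IV-⊘⊖⇒⊗⊗ (D-r (⊘ₗ _ _) _ _ _ _ _) _ ()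
IV-⊘⊖⇒⊗⊗ (D-r (⊘ᵣ _ _) _ _ _ _ _) _ ()

lemma34 : (X : Neg → Set) (Π₁ Π₂ Σ₁ Σ₂ : Str) →
    Focused X Π₁ → Focused X Π₂ → Focused X Σ₁ → Focused X Σ₂ →
    ((X ∣ RI1 ⊩ (Π₂ ·⊘· Σ₂) , (Σ₁ ·⊘· Π₁) ⊢ → X ∣ RI1 ⊩ (Π₁ ·⊗· Π₂) , (Σ₂ ·⊗· Σ₁) ⊢)
    × (X ∣ RI2 ⊩ (Σ₁ ·⊖· Π₁) , (Π₂ ·⊖· Σ₂) ⊢ → X ∣ RI2 ⊩ (Π₁ ·⊗· Π₂) , (Σ₂ ·⊗· Σ₁) ⊢)
    × (X ∣ RIV ⊩ (Σ₂ ·⊘· Π₁) , (Σ₁ ·⊖· Π₂) ⊢ → X ∣ RIV ⊩ (Π₁ ·⊗· Π₂) , (Σ₂ ·⊗· Σ₁) ⊢))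
lemma34 X Π₁ Π₂ Σ₁ Σ₂ _ _ _ _ =
    (λ d → I1-⊘⊘⇒⊗⊗ d refl refl)
  , (λ d → I2-⊖⊖⇒⊗⊗ d refl refl)
  , (λ d → IV-⊘⊖⇒⊗⊗ d refl refl)
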